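{- A $3$-graph $H$ is $\{(4,2),(4,4)\}$-free if and only if every tight component of $H$ is a star.
   Context: A $3$-graph is a pair $H=(V,E)$ with $E\subseteq\binom{V}{3}$. $H$ is $\{(4,2),(4,4)\}$-free if no $4$-vertex subset of $V(H)$ spans exactly $2$ or exactly $4$ edges. A tight walk from an edge $e$ to an edge $e'$ is a sequence of edges $e=f_1,\dots,f_k=e'$ with $|f_i\cap f_{i+1}|=2$ for all $i$. A tight component is a maximal (under inclusion) set $C$ of edges such that any two distinct edges of $C$ are joined by a tight walk. A star $(v,S)$, for a vertex $v$ and a set $S$ not containing $v$, is the set of triples $\{vxy : x,y\in S,\ x\neq y\}$; a tight component is a star if it equals the edge set of some star. -}

module Defs where

open import Data.Nat using (ℕ; zero; suc)
open import Data.Bool using (Bool; true; false)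
open import Data.Bool.Properties using () renaming (_≟_ to _≟ᵇ_)
open import Data.Fin using (Fin)
open import Data.Fin.Subset using (Subset; _∈_; _∉_; _⊆_; _∩_; _∪_; ⁅_⁆; ∣_∣)
open import Data.Fin.Subset.Properties using (_⊆?_)
open import Data.Vec using (_∷_; [])
open import Data.List using (List; _∷_; []; map; _++_; filter; length)
open import Data.Product using (Σ; ∃; ∃-syntax; _×_; _,_)
open import Relation.Nullary using (¬_)
open import Relation.Nullary.Decidable using (_×-dec_)
open import Relation.Binary.PropositionalEquality using (_≡_; _≢_)
open import Relation.Binary.Construct.Closure.ReflexiveTransitive using (Star)

record ThreeGraph (n : ℕ) : Set where
  field
    edge    : Subset n → Bool
    uniform : ∀ (e : Subset n) → edge e ≡ true → ∣ e ∣ ≡ 3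
open ThreeGraph public

IsEdge : ∀ {n} → ThreeGraph n → Subset n → Set
IsEdge H e = edge H e ≡ true

allSubsets : (n : ℕ) → List (Subset n)
allSubsets zero    = [] ∷ []
allSubsets (suc n) = map (false ∷_) (allSubsets n) ++ map (true ∷_) (allSubsets n)

spannedEdges : ∀ {n} → ThreeGraph n → Subset n → ℕ
spannedEdges {n} H S =
  length (filter (λ T → (T ⊆? S) ×-dec (edge H T ≟ᵇ true)) (allSubsets n))

Free-4,2-4,4 : ∀ {n} → ThreeGraph n → Set
Free-4,2-4,4 {n} H =
  ∀ (S : Subset n) → ∣ S ∣ ≡ 4 →
    ¬ (spannedEdges H S ≡ 2) × ¬ (spannedEdges H S ≡ 4)

TightStep : ∀ {n} → ThreeGraph n → Subset n → Subset n → Set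
TightStep H e f = IsEdge H e × IsEdge H f × ∣ e ∩ f ∣ ≡ 2

TightWalk : ∀ {n} → ThreeGraph n → Subset n → Subset n → Set
TightWalk H = Star (TightStep H)

TightlyConnectedSet : ∀ {n} → ThreeGraph n → (Subset n → Set) → Set
TightlyConnectedSet {n} H C =
  (∀ e → C e → IsEdge H e) ×
  (∀ e f → C e → C f → e ≢ f → TightWalk H e f)

IsTightComponent : ∀ {n} → ThreeGraph n → (Subset n → Set) → Set₁
IsTightComponent {n} H C =
  TightlyConnectedSet H C ×
  (∃[ e ] C e) ×
  (∀ (D : Subset n → Set) → TightlyConnectedSet H D →
     (∀ e → C e → D e) → (∀ e → D e → C e))

StarTriple : ∀ {n} → Fin n → Subset n → Subset n → Set
StarTriple v S e =
  ∃[ x ] ∃[ y ] (x ∈ S × y ∈ S × x ≢ y × e ≡ (⁅ v ⁆ ∪ ⁅ x ⁆) ∪ ⁅ y ⁆)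

IsStar : ∀ {n} → (Subset n → Set) → Set
IsStar {n} C =
  ∃[ v ] ∃[ S ] (v ∉ S × (∀ e → C e → StarTriple v S e)
                       × (∀ e → StarTriple v S e → C e))

-- A 4-set spanning neither 2 nor 4 edges amounts to two local rules (FourSetRules): two
-- edges abc, abd force acd or bcd, and no 4-set spans all four of its triples. The
-- equivalence is a count over the four triples of a 4-set.
--
-- In a star component every edge contains the centre. So if abc, abd are edges, the
-- centre of their component is a or b while c, d are leaves, and the star supplies acd or
-- bcd; a K₄ would put all four triples of a 4-set into one component, though no vertex
-- lies in all of them.
--
-- Conversely, assume the rules. An edge without tight neighbours is a star with two
-- leaves. Otherwise two edges sharing a pair extend to a fan vxy, vxz, vyz, and the rules
-- on the 4-subsets of {v, x, y, z, w} show that vxw forces vyw. Hence the leaves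
-- {x} ∪ {u : vxu ∈ H} are pairwise joined through v. A tight step out of this complete
-- star either stays in it or reaches an edge u₁u₂w avoiding v, which would span a K₄ with
-- the star. The complete star is tightly connected, so it is the whole component.

module Submission where

open import Data.Bool using (Bool; true; false)
open import Data.Bool.Properties using (¬-not) renaming (_≟_ to _≟ᵇ_)
open import Data.Empty using (⊥-elim)
open import Data.Fin using (Fin; zero; suc)
open import Data.Fin.Properties using (_≟_)
open import Data.Fin.Subset
open import Data.Fin.Subset.Properties
open import Data.List using ([]; _∷_; _++_; map; filter; length)
open import Data.List.Properties using (filter-++; filter-≐; filter-none; length-++)
open import Data.List.Relation.Unary.All using (universal)
open import Data.Nat using (ℕ; zero; suc; _+_; _≤_; s≤s; z≤n)
import Data.Nat as ℕ
open import Data.Nat.Properties using (≤-trans; ≤-reflexive; <-irrefl; +-suc; +-monoʳ-≤; n≤1+n)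
open import Data.Product using (Σ-syntax; ∃₂; _×_; _,_; proj₁; proj₂)
open import Data.Sum using (_⊎_; inj₁; inj₂)
import Data.Sum as Sum
import Data.Product as Product
open import Data.Vec using (_∷_; []; here; there; tabulate)
open import Data.Vec.Properties using (≡-dec; ∷-injectiveˡ; ∷-injectiveʳ; lookup∘tabulate; []=⇒lookup; lookup⇒[]=)
open import Level using (0ℓ)
open import Function using (_∘_; id)
open import Relation.Binary.PropositionalEquality
open import Relation.Binary.Construct.Closure.ReflexiveTransitive using (ε; _◅_; _◅◅_; reverse)
open import Relation.Binary using (DecidableEquality)
open import Relation.Nullary using (¬_; Dec; yes; no)
open import Relation.Nullary.Decidable using (_×-dec_)
open import Relation.Unary using (Pred; Decidable; _≐_)
open import Relation.Unary.Properties using (_∪?_)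

open import Defs

private
  variable
    n k : ℕ
    a b c d u v w x y z : Fin n
    p q e f g : Subset n
    C : Subset n → Set
    S : Subset n

-- Triples and quadruples of vertices

triple : Fin n → Fin n → Fin n → Subset n
triple a b c = (⁅ a ⁆ ∪ ⁅ b ⁆) ∪ ⁅ c ⁆

quad : Fin n → Fin n → Fin n → Fin n → Subset n
quad a b c d = triple a b c ∪ ⁅ d ⁆

∈∪⁅⁆⁻ : ∀ (p : Subset n) → u ∈ p ∪ ⁅ x ⁆ → u ∈ p ⊎ u ≡ x
∈∪⁅⁆⁻ {x = x} p u∈ = Sum.map₂ (x∈⁅y⁆⇒x≡y x) (x∈p∪q⁻ p ⁅ x ⁆ u∈)

∈∪⁅⁆⁺ : ∀ (p : Subset n) → u ∈ p ⊎ u ≡ x → u ∈ p ∪ ⁅ x ⁆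
∈∪⁅⁆⁺ p (inj₁ u∈p) = x∈p∪q⁺ (inj₁ u∈p)
∈∪⁅⁆⁺ p (inj₂ refl) = x∈p∪q⁺ (inj₂ (x∈⁅x⁆ _))

∈pair⁻ : u ∈ ⁅ a ⁆ ∪ ⁅ b ⁆ → u ≡ a ⊎ u ≡ b
∈pair⁻ {a = a} u∈ = Sum.map₁ (x∈⁅y⁆⇒x≡y a) (∈∪⁅⁆⁻ ⁅ a ⁆ u∈)

∈pair⁺ : u ≡ a ⊎ u ≡ b → u ∈ ⁅ a ⁆ ∪ ⁅ b ⁆
∈pair⁺ {a = a} = ∈∪⁅⁆⁺ ⁅ a ⁆ ∘ Sum.map₁ (λ { refl → x∈⁅x⁆ a })

∈triple⁻ : u ∈ triple a b c → u ≡ a ⊎ u ≡ b ⊎ u ≡ c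
∈triple⁻ {a = a} {b = b} u∈ with ∈∪⁅⁆⁻ (⁅ a ⁆ ∪ ⁅ b ⁆) u∈
... | inj₁ u∈ab = Sum.map₂ inj₁ (∈pair⁻ u∈ab)
... | inj₂ u≡c  = inj₂ (inj₂ u≡c)

∈triple⁺ : u ≡ a ⊎ u ≡ b ⊎ u ≡ c → u ∈ triple a b c
∈triple⁺ {a = a} {b = b} (inj₁ u≡a)         = ∈∪⁅⁆⁺ (⁅ a ⁆ ∪ ⁅ b ⁆) (inj₁ (∈pair⁺ (inj₁ u≡a)))
∈triple⁺ {a = a} {b = b} (inj₂ (inj₁ u≡b)) = ∈∪⁅⁆⁺ (⁅ a ⁆ ∪ ⁅ b ⁆) (inj₁ (∈pair⁺ (inj₂ u≡b)))
∈triple⁺ {a = a} {b = b} (inj₂ (inj₂ u≡c)) = ∈∪⁅⁆⁺ (⁅ a ⁆ ∪ ⁅ b ⁆) (inj₂ u≡c)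

∉triple : u ≢ a → u ≢ b → u ≢ c → u ∉ triple a b c
∉triple u≢a u≢b u≢c u∈ with ∈triple⁻ u∈
... | inj₁ u≡a         = u≢a u≡a
... | inj₂ (inj₁ u≡b) = u≢b u≡b
... | inj₂ (inj₂ u≡c) = u≢c u≡c

∉triple⁻ : u ∉ triple a b c → a ≢ u × b ≢ u × c ≢ u
∉triple⁻ u∉ = (λ { refl → u∉ (∈triple⁺ (inj₁ refl)) }) ,
              (λ { refl → u∉ (∈triple⁺ (inj₂ (inj₁ refl))) }) ,
              (λ { refl → u∉ (∈triple⁺ (inj₂ (inj₂ refl))) })

∈quad⁻ : u ∈ quad a b c d → u ≡ a ⊎ u ≡ b ⊎ u ≡ c ⊎ u ≡ d
∈quad⁻ {a = a} {b = b} {c = c} u∈ with ∈∪⁅⁆⁻ (triple a b c) u∈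
... | inj₁ u∈abc = Sum.map₂ (Sum.map₂ inj₁) (∈triple⁻ u∈abc)
... | inj₂ u≡d   = inj₂ (inj₂ (inj₂ u≡d))

∈quad⁺ : u ≡ a ⊎ u ≡ b ⊎ u ≡ c ⊎ u ≡ d → u ∈ quad a b c d
∈quad⁺ {a = a} {b = b} {c = c} (inj₂ (inj₂ (inj₂ u≡d))) = ∈∪⁅⁆⁺ (triple a b c) (inj₂ u≡d)
∈quad⁺ {a = a} {b = b} {c = c} (inj₁ u≡a)               = ∈∪⁅⁆⁺ (triple a b c) (inj₁ (∈triple⁺ (inj₁ u≡a)))
∈quad⁺ {a = a} {b = b} {c = c} (inj₂ (inj₁ u≡b))       = ∈∪⁅⁆⁺ (triple a b c) (inj₁ (∈triple⁺ (inj₂ (inj₁ u≡b))))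
∈quad⁺ {a = a} {b = b} {c = c} (inj₂ (inj₂ (inj₁ u≡c))) = ∈∪⁅⁆⁺ (triple a b c) (inj₁ (∈triple⁺ (inj₂ (inj₂ u≡c))))

triple-swap : ∀ (a b c : Fin n) → triple a b c ≡ triple b a c
triple-swap a b c = cong (_∪ ⁅ c ⁆) (∪-comm ⁅ a ⁆ ⁅ b ⁆)

triple-flip : ∀ (a b c : Fin n) → triple a b c ≡ triple a c b
triple-flip a b c = begin
  (⁅ a ⁆ ∪ ⁅ b ⁆) ∪ ⁅ c ⁆ ≡⟨ ∪-assoc ⁅ a ⁆ ⁅ b ⁆ ⁅ c ⁆ ⟩
  ⁅ a ⁆ ∪ (⁅ b ⁆ ∪ ⁅ c ⁆) ≡⟨ cong (⁅ a ⁆ ∪_) (∪-comm ⁅ b ⁆ ⁅ c ⁆) ⟩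
  ⁅ a ⁆ ∪ (⁅ c ⁆ ∪ ⁅ b ⁆) ≡⟨ ∪-assoc ⁅ a ⁆ ⁅ c ⁆ ⁅ b ⁆ ⟨
  (⁅ a ⁆ ∪ ⁅ c ⁆) ∪ ⁅ b ⁆ ∎
  where open ≡-Reasoning

triple-rot : ∀ (a b c : Fin n) → triple a b c ≡ triple b c a
triple-rot a b c = trans (triple-swap a b c) (triple-flip b a c)

∈tabulate⁻ : ∀ {f : Fin n → Bool} → u ∈ tabulate f → f u ≡ true
∈tabulate⁻ {u = u} {f = f} u∈ = trans (sym (lookup∘tabulate f u)) ([]=⇒lookup u∈)

∈tabulate⁺ : ∀ {f : Fin n → Bool} → f u ≡ true → u ∈ tabulate f
∈tabulate⁺ {u = u} {f = f} fu = lookup⇒[]= u (tabulate f) (trans (lookup∘tabulate f u) fu)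

∣p∪⁅x⁆∣≡1+∣p∣ : ∀ (p : Subset n) → x ∉ p → ∣ p ∪ ⁅ x ⁆ ∣ ≡ suc ∣ p ∣
∣p∪⁅x⁆∣≡1+∣p∣ {x = zero}  (inside  ∷ p) x∉p = ⊥-elim (x∉p here)
∣p∪⁅x⁆∣≡1+∣p∣ {x = zero}  (outside ∷ p) x∉p = cong (suc ∘ ∣_∣) (∪-identityʳ p)
∣p∪⁅x⁆∣≡1+∣p∣ {x = suc x} (inside  ∷ p) x∉p = cong suc (∣p∪⁅x⁆∣≡1+∣p∣ p (x∉p ∘ there))
∣p∪⁅x⁆∣≡1+∣p∣ {x = suc x} (outside ∷ p) x∉p = ∣p∪⁅x⁆∣≡1+∣p∣ p (x∉p ∘ there)

∣p∪q∣≤∣p∣+∣q∣ : ∀ (p q : Subset n) → ∣ p ∪ q ∣ ≤ ∣ p ∣ + ∣ q ∣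
∣p∪q∣≤∣p∣+∣q∣ []            []            = z≤n
∣p∪q∣≤∣p∣+∣q∣ (outside ∷ p) (outside ∷ q) = ∣p∪q∣≤∣p∣+∣q∣ p q
∣p∪q∣≤∣p∣+∣q∣ (outside ∷ p) (inside  ∷ q) =
  subst (suc ∣ p ∪ q ∣ ≤_) (sym (+-suc ∣ p ∣ ∣ q ∣)) (s≤s (∣p∪q∣≤∣p∣+∣q∣ p q))
∣p∪q∣≤∣p∣+∣q∣ (inside  ∷ p) (outside ∷ q) = s≤s (∣p∪q∣≤∣p∣+∣q∣ p q)
∣p∪q∣≤∣p∣+∣q∣ (inside  ∷ p) (inside  ∷ q) =
  s≤s (≤-trans (∣p∪q∣≤∣p∣+∣q∣ p q) (+-monoʳ-≤ ∣ p ∣ (n≤1+n ∣ q ∣)))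

Distinct : Fin n → Fin n → Fin n → Set
Distinct a b c = a ≢ b × a ≢ c × b ≢ c

distinct₁₂ : Distinct a b c → a ≢ b
distinct₁₂ = proj₁

distinct₁₃ : Distinct a b c → a ≢ c
distinct₁₃ = proj₁ ∘ proj₂

distinct₂₃ : Distinct a b c → b ≢ c
distinct₂₃ = proj₂ ∘ proj₂

∣pair∣≡2 : a ≢ b → ∣ ⁅ a ⁆ ∪ ⁅ b ⁆ ∣ ≡ 2
∣pair∣≡2 {a = a} a≢b =
  trans (∣p∪⁅x⁆∣≡1+∣p∣ ⁅ a ⁆ (x≢y⇒x∉⁅y⁆ (≢-sym a≢b))) (cong suc (∣⁅x⁆∣≡1 a))

∣pair∣≤2 : ∣ ⁅ a ⁆ ∪ ⁅ b ⁆ ∣ ≤ 2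
∣pair∣≤2 {a = a} {b = b} =
  ≤-trans (∣p∪q∣≤∣p∣+∣q∣ ⁅ a ⁆ ⁅ b ⁆) (≤-reflexive (cong₂ _+_ (∣⁅x⁆∣≡1 a) (∣⁅x⁆∣≡1 b)))

∣triple∣≡3 : Distinct a b c → ∣ triple a b c ∣ ≡ 3
∣triple∣≡3 {a = a} {b = b} (a≢b , a≢c , b≢c) =
  trans (∣p∪⁅x⁆∣≡1+∣p∣ (⁅ a ⁆ ∪ ⁅ b ⁆) c∉ab) (cong suc (∣pair∣≡2 a≢b))
  where
  c∉ab = Sum.[ a≢c ∘ sym , b≢c ∘ sym ] ∘ ∈pair⁻

∣triple∣≡3⇒distinct : ∣ triple a b c ∣ ≡ 3 → Distinct a b c
∣triple∣≡3⇒distinct {a = a} {b = b} {c = c} ∣abc∣≡3 =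
  (λ { refl → inside-pair a c λ { (inj₁ e) → inj₁ e ; (inj₂ (inj₁ e)) → inj₁ e ; (inj₂ (inj₂ e)) → inj₂ e } }) ,
  (λ { refl → inside-pair a b λ { (inj₁ e) → inj₁ e ; (inj₂ (inj₁ e)) → inj₂ e ; (inj₂ (inj₂ e)) → inj₁ e } }) ,
  (λ { refl → inside-pair a b λ { (inj₁ e) → inj₁ e ; (inj₂ (inj₁ e)) → inj₂ e ; (inj₂ (inj₂ e)) → inj₂ e } })
  where
  inside-pair : ∀ x y → ¬ (∀ {u} → u ≡ a ⊎ u ≡ b ⊎ u ≡ c → u ≡ x ⊎ u ≡ y)
  inside-pair x y f
    with ≤-trans (≤-reflexive (sym ∣abc∣≡3))
                 (≤-trans (p⊆q⇒∣p∣≤∣q∣ (∈pair⁺ ∘ f ∘ ∈triple⁻)) (∣pair∣≤2 {a = x} {b = y}))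
  ... | s≤s (s≤s ())

∣p∣≡1+k⇒p≡q∪⁅x⁆ : ∀ (p : Subset n) → ∣ p ∣ ≡ suc k →
                  ∃₂ λ q x → x ∉ q × ∣ q ∣ ≡ k × p ≡ q ∪ ⁅ x ⁆
∣p∣≡1+k⇒p≡q∪⁅x⁆ (inside ∷ p) refl =
  outside ∷ p , zero , (λ ()) , refl , cong (inside ∷_) (sym (∪-identityʳ p))
∣p∣≡1+k⇒p≡q∪⁅x⁆ (outside ∷ p) ∣p∣≡1+k with ∣p∣≡1+k⇒p≡q∪⁅x⁆ p ∣p∣≡1+k
... | q , x , x∉q , ∣q∣≡k , refl = outside ∷ q , suc x , (λ { (there x∈q) → x∉q x∈q }) , ∣q∣≡k , refl

∣p∣≡0⇒p≡⊥ : ∀ (p : Subset n) → ∣ p ∣ ≡ 0 → p ≡ ⊥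
∣p∣≡0⇒p≡⊥ []            _     = refl
∣p∣≡0⇒p≡⊥ (outside ∷ p) ∣p∣≡0 = cong (outside ∷_) (∣p∣≡0⇒p≡⊥ p ∣p∣≡0)

triple-view : ∀ (p : Subset n) → ∣ p ∣ ≡ 3 → Σ[ a ∈ Fin n ] Σ[ b ∈ Fin n ] Σ[ c ∈ Fin n ] p ≡ triple a b c
triple-view p ∣p∣≡3 with ∣p∣≡1+k⇒p≡q∪⁅x⁆ p ∣p∣≡3
... | q , c , _ , ∣q∣≡2 , refl with ∣p∣≡1+k⇒p≡q∪⁅x⁆ q ∣q∣≡2
... | r , b , _ , ∣r∣≡1 , refl with ∣p∣≡1+k⇒p≡q∪⁅x⁆ r ∣r∣≡1
... | s , a , _ , ∣s∣≡0 , refl rewrite ∣p∣≡0⇒p≡⊥ s ∣s∣≡0 | ∪-identityˡ ⁅ a ⁆ = a , b , c , refl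

quad-view : ∀ (p : Subset n) → ∣ p ∣ ≡ 4 →
            Σ[ a ∈ Fin n ] Σ[ b ∈ Fin n ] Σ[ c ∈ Fin n ] Σ[ d ∈ Fin n ]
              Distinct a b c × d ∉ triple a b c × p ≡ quad a b c d
quad-view p ∣p∣≡4 with ∣p∣≡1+k⇒p≡q∪⁅x⁆ p ∣p∣≡4
... | q , d , d∉q , ∣q∣≡3 , refl with triple-view q ∣q∣≡3
... | a , b , c , refl = a , b , c , d , ∣triple∣≡3⇒distinct ∣q∣≡3 , d∉q , refl

∣triple∩triple∣≡2 : a ≢ b → c ∉ triple a b d → ∣ triple a b c ∩ triple a b d ∣ ≡ 2
∣triple∩triple∣≡2 {a = a} {b = b} {c = c} {d = d} a≢b c∉abd =
  trans (cong ∣_∣ (⊆-antisym common⊆ab ab⊆common)) (∣pair∣≡2 a≢b)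
  where
  common⊆ab : triple a b c ∩ triple a b d ⊆ ⁅ a ⁆ ∪ ⁅ b ⁆
  common⊆ab u∈ with x∈p∩q⁻ (triple a b c) (triple a b d) u∈
  ... | u∈abc , u∈abd with ∈triple⁻ u∈abc
  ... | inj₁ u≡a         = ∈pair⁺ (inj₁ u≡a)
  ... | inj₂ (inj₁ u≡b) = ∈pair⁺ (inj₂ u≡b)
  ... | inj₂ (inj₂ refl) = ⊥-elim (c∉abd u∈abd)
  ab⊆common : ⁅ a ⁆ ∪ ⁅ b ⁆ ⊆ triple a b c ∩ triple a b d
  ab⊆common u∈ with ∈pair⁻ u∈
  ... | inj₁ u≡a = x∈p∩q⁺ (∈triple⁺ (inj₁ u≡a) , ∈triple⁺ (inj₁ u≡a))
  ... | inj₂ u≡b = x∈p∩q⁺ (∈triple⁺ (inj₂ (inj₁ u≡b)) , ∈triple⁺ (inj₂ (inj₁ u≡b)))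

triple-front : u ∈ triple a b c → Σ[ s ∈ Fin n ] Σ[ t ∈ Fin n ] triple a b c ≡ triple u s t
triple-front {a = a} {b = b} {c = c} u∈ with ∈triple⁻ u∈
... | inj₁ refl         = b , c , refl
... | inj₂ (inj₁ refl) = a , c , triple-swap a b c
... | inj₂ (inj₂ refl) = a , b , trans (triple-flip a b c) (triple-swap a c b)

two-in-triple : ∀ (p : Subset n) → ∣ p ∣ ≡ 3 → x ∈ p → y ∈ p → x ≢ y → Σ[ w ∈ Fin n ] p ≡ triple x y w
two-in-triple {x = x} {y = y} p ∣p∣≡3 x∈p y∈p x≢y with triple-view p ∣p∣≡3
... | _ , _ , _ , refl with triple-front x∈p
... | s , t , eq with ∈triple⁻ (subst (y ∈_) eq y∈p)
... | inj₁ refl         = ⊥-elim (x≢y refl)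
... | inj₂ (inj₁ refl) = t , eq
... | inj₂ (inj₂ refl) = s , trans eq (triple-flip x s y)

module _ (g : Subset n) (∣g∣≡3 : ∣ g ∣ ≡ 3) {a b c : Fin n} (∣I∣≡2 : ∣ triple a b c ∩ g ∣ ≡ 2) where

  private
    no-three-common : ∀ {p} → ∣ p ∣ ≡ 3 → ¬ (p ⊆ triple a b c ∩ g)
    no-three-common ∣p∣≡3 p⊆I
      with ≤-trans (≤-reflexive (sym ∣p∣≡3)) (≤-trans (p⊆q⇒∣p∣≤∣q∣ p⊆I) (≤-reflexive ∣I∣≡2))
    ... | s≤s (s≤s ())

    common-only : ∀ x → ¬ (∀ {u} → u ≡ a ⊎ u ≡ b ⊎ u ≡ c → u ∈ g → u ≡ x)
    common-only x only
      with ≤-trans (≤-reflexive (sym ∣I∣≡2)) (≤-trans (p⊆q⇒∣p∣≤∣q∣ I⊆x) (≤-reflexive (∣⁅x⁆∣≡1 x)))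
      where
      I⊆x : triple a b c ∩ g ⊆ ⁅ x ⁆
      I⊆x u∈ with x∈p∩q⁻ (triple a b c) g u∈
      ... | u∈abc , u∈g rewrite only (∈triple⁻ u∈abc) u∈g = x∈⁅x⁆ x
    ... | s≤s ()

    through : x ∈ triple a b c → y ∈ triple a b c → x ∈ g → y ∈ g → x ≢ y →
              Σ[ w ∈ Fin n ] w ∉ triple a b c × g ≡ triple x y w
    through x∈abc y∈abc x∈g y∈g x≢y with two-in-triple g ∣g∣≡3 x∈g y∈g x≢y
    ... | w , g≡xyw = w , (λ w∈abc → no-three-common ∣g∣≡3 λ u∈g → x∈p∩q⁺ (g⊆abc w∈abc u∈g , u∈g)) , g≡xyw
      where
      g⊆abc : w ∈ triple a b c → g ⊆ triple a b c
      g⊆abc w∈abc u∈g with ∈triple⁻ (subst (_ ∈_) g≡xyw u∈g)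
      ... | inj₁ refl         = x∈abc
      ... | inj₂ (inj₁ refl) = y∈abc
      ... | inj₂ (inj₂ refl) = w∈abc

    a∈abc : a ∈ triple a b c
    a∈abc = ∈triple⁺ (inj₁ refl)
    b∈abc : b ∈ triple a b c
    b∈abc = ∈triple⁺ (inj₂ (inj₁ refl))
    c∈abc : c ∈ triple a b c
    c∈abc = ∈triple⁺ (inj₂ (inj₂ refl))

  step-shape : Distinct a b c →
    Σ[ w ∈ Fin n ] w ∉ triple a b c × (g ≡ triple a b w ⊎ g ≡ triple a c w ⊎ g ≡ triple b c w)
  step-shape abc@(a≢b , a≢c , b≢c) with a ∈? g | b ∈? g | c ∈? g
  ... | yes a∈g | yes b∈g | yes c∈g =
    ⊥-elim (no-three-common (∣triple∣≡3 abc) λ u∈ → x∈p∩q⁺ (u∈ , abc⊆g (∈triple⁻ u∈)))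
    where
    abc⊆g : ∀ {u} → u ≡ a ⊎ u ≡ b ⊎ u ≡ c → u ∈ g
    abc⊆g (inj₁ refl)         = a∈g
    abc⊆g (inj₂ (inj₁ refl)) = b∈g
    abc⊆g (inj₂ (inj₂ refl)) = c∈g
  ... | yes a∈g | yes b∈g | no _    =
    Product.map₂ (Product.map₂ inj₁) (through a∈abc b∈abc a∈g b∈g a≢b)
  ... | yes a∈g | no _    | yes c∈g =
    Product.map₂ (Product.map₂ (inj₂ ∘ inj₁)) (through a∈abc c∈abc a∈g c∈g a≢c)
  ... | no _    | yes b∈g | yes c∈g =
    Product.map₂ (Product.map₂ (inj₂ ∘ inj₂)) (through b∈abc c∈abc b∈g c∈g b≢c)
  ... | yes _   | no b∉g  | no c∉g  = ⊥-elim (common-only a λ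
    { (inj₁ u≡a) _ → u≡a
    ; (inj₂ (inj₁ refl)) u∈g → ⊥-elim (b∉g u∈g)
    ; (inj₂ (inj₂ refl)) u∈g → ⊥-elim (c∉g u∈g) })
  ... | no a∉g  | yes _   | no c∉g  = ⊥-elim (common-only b λ
    { (inj₁ refl) u∈g → ⊥-elim (a∉g u∈g)
    ; (inj₂ (inj₁ u≡b)) _ → u≡b
    ; (inj₂ (inj₂ refl)) u∈g → ⊥-elim (c∉g u∈g) })
  ... | no a∉g  | no b∉g  | _       = ⊥-elim (common-only c λ
    { (inj₁ refl) u∈g → ⊥-elim (a∉g u∈g)
    ; (inj₂ (inj₁ refl)) u∈g → ⊥-elim (b∉g u∈g)
    ; (inj₂ (inj₂ u≡c)) _ → u≡c })

⊆∧∣q∣≤∣p∣⇒≡ : p ⊆ q → ∣ q ∣ ≤ ∣ p ∣ → p ≡ q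
⊆∧∣q∣≤∣p∣⇒≡ {p = p} {q = q} p⊆q ∣q∣≤∣p∣ = ⊆-antisym p⊆q q⊆p
  where
  q⊆p : q ⊆ p
  q⊆p {u} u∈q with u ∈? p
  ... | yes u∈p = u∈p
  ... | no u∉p  = ⊥-elim (<-irrefl refl (≤-trans (p⊂q⇒∣p∣<∣q∣ (p⊆q , u , u∈q , u∉p)) ∣q∣≤∣p∣))

⊆triple⇒≡ : ∣ p ∣ ≡ 3 → Distinct x y z → (∀ {u} → u ∈ p → u ≡ x ⊎ u ≡ y ⊎ u ≡ z) → p ≡ triple x y z
⊆triple⇒≡ ∣p∣≡3 xyz onto = ⊆∧∣q∣≤∣p∣⇒≡ (∈triple⁺ ∘ onto) (≤-reflexive (trans (∣triple∣≡3 xyz) (sym ∣p∣≡3)))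

module _ {a b c d : Fin n} (abc : Distinct a b c) (d∉abc : d ∉ triple a b c) where

  private
    a≢d = proj₁ (∉triple⁻ d∉abc)
    b≢d = proj₁ (proj₂ (∉triple⁻ d∉abc))
    c≢d = proj₂ (proj₂ (∉triple⁻ d∉abc))

  ∣quad∣≡4 : ∣ quad a b c d ∣ ≡ 4
  ∣quad∣≡4 = trans (∣p∪⁅x⁆∣≡1+∣p∣ (triple a b c) d∉abc) (cong suc (∣triple∣≡3 abc))

  3-subset-of-quad : ∀ (p : Subset n) → ∣ p ∣ ≡ 3 → p ⊆ quad a b c d →
    p ≡ triple a b c ⊎ p ≡ triple a b d ⊎ p ≡ triple a c d ⊎ p ≡ triple b c d
  3-subset-of-quad p ∣p∣≡3 p⊆abcd with d ∈? p | c ∈? p | b ∈? p | a ∈? p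
  ... | no d∉p | _ | _ | _ = inj₁ (⊆triple⇒≡ ∣p∣≡3 abc λ u∈p → case (∈quad⁻ (p⊆abcd u∈p)) u∈p)
    where
    case : u ≡ a ⊎ u ≡ b ⊎ u ≡ c ⊎ u ≡ d → u ∈ p → u ≡ a ⊎ u ≡ b ⊎ u ≡ c
    case (inj₁ e)                 _   = inj₁ e
    case (inj₂ (inj₁ e))         _   = inj₂ (inj₁ e)
    case (inj₂ (inj₂ (inj₁ e))) _   = inj₂ (inj₂ e)
    case (inj₂ (inj₂ (inj₂ refl))) u∈p = ⊥-elim (d∉p u∈p)
  ... | yes _ | no c∉p | _ | _ =
    inj₂ (inj₁ (⊆triple⇒≡ ∣p∣≡3 (distinct₁₂ abc , a≢d , b≢d) λ u∈p → case (∈quad⁻ (p⊆abcd u∈p)) u∈p))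
    where
    case : u ≡ a ⊎ u ≡ b ⊎ u ≡ c ⊎ u ≡ d → u ∈ p → u ≡ a ⊎ u ≡ b ⊎ u ≡ d
    case (inj₁ e)                 _   = inj₁ e
    case (inj₂ (inj₁ e))         _   = inj₂ (inj₁ e)
    case (inj₂ (inj₂ (inj₁ refl))) u∈p = ⊥-elim (c∉p u∈p)
    case (inj₂ (inj₂ (inj₂ e))) _   = inj₂ (inj₂ e)
  ... | yes _ | yes _ | no b∉p | _ =
    inj₂ (inj₂ (inj₁ (⊆triple⇒≡ ∣p∣≡3 (distinct₁₃ abc , a≢d , c≢d) λ u∈p → case (∈quad⁻ (p⊆abcd u∈p)) u∈p)))
    where
    case : u ≡ a ⊎ u ≡ b ⊎ u ≡ c ⊎ u ≡ d → u ∈ p → u ≡ a ⊎ u ≡ c ⊎ u ≡ d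
    case (inj₁ e)                 _   = inj₁ e
    case (inj₂ (inj₁ refl))       u∈p = ⊥-elim (b∉p u∈p)
    case (inj₂ (inj₂ (inj₁ e))) _   = inj₂ (inj₁ e)
    case (inj₂ (inj₂ (inj₂ e))) _   = inj₂ (inj₂ e)
  ... | yes _ | yes _ | yes _ | no a∉p =
    inj₂ (inj₂ (inj₂ (⊆triple⇒≡ ∣p∣≡3 (distinct₂₃ abc , b≢d , c≢d) λ u∈p → case (∈quad⁻ (p⊆abcd u∈p)) u∈p)))
    where
    case : u ≡ a ⊎ u ≡ b ⊎ u ≡ c ⊎ u ≡ d → u ∈ p → u ≡ b ⊎ u ≡ c ⊎ u ≡ d
    case (inj₁ refl)              u∈p = ⊥-elim (a∉p u∈p)
    case (inj₂ e)                 _   = e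
  ... | yes d∈p | yes c∈p | yes b∈p | yes a∈p =
    ⊥-elim (4≰3 (subst₂ _≤_ ∣quad∣≡4 ∣p∣≡3 (p⊆q⇒∣p∣≤∣q∣ abcd⊆p)))
    where
    4≰3 : ¬ (4 ≤ 3)
    4≰3 (s≤s (s≤s (s≤s ())))
    abcd⊆p : quad a b c d ⊆ p
    abcd⊆p u∈ with ∈quad⁻ u∈
    ... | inj₁ refl                 = a∈p
    ... | inj₂ (inj₁ refl)         = b∈p
    ... | inj₂ (inj₂ (inj₁ refl)) = c∈p
    ... | inj₂ (inj₂ (inj₂ refl)) = d∈p

center∈ : StarTriple v S e → v ∈ e
center∈ (_ , _ , _ , _ , _ , refl) = ∈triple⁺ (inj₁ refl)

leaf∈ : StarTriple v S e → u ∈ e → u ≢ v → u ∈ S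
leaf∈ (_ , _ , x∈S , y∈S , _ , refl) u∈e u≢v with ∈triple⁻ u∈e
... | inj₁ u≡v         = ⊥-elim (u≢v u≡v)
... | inj₂ (inj₁ refl) = x∈S
... | inj₂ (inj₂ refl) = y∈S

module _ {A : Set} {P Q : Pred A 0ℓ} (P? : Decidable P) (Q? : Decidable Q) where

  length-filter-∪ : (∀ {x} → P x → ¬ Q x) → ∀ xs →
    length (filter (P? ∪? Q?) xs) ≡ length (filter P? xs) + length (filter Q? xs)
  length-filter-∪ disjoint []       = refl
  length-filter-∪ disjoint (x ∷ xs) with P? x | Q? x
  ... | yes px | yes qx = ⊥-elim (disjoint px qx)
  ... | yes _  | no _   = cong suc (length-filter-∪ disjoint xs)
  ... | no _   | yes _  = trans (cong suc (length-filter-∪ disjoint xs)) (sym (+-suc _ _))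
  ... | no _   | no _   = length-filter-∪ disjoint xs

length-filter-none : ∀ {A : Set} {P : Pred A 0ℓ} (P? : Decidable P) → (∀ x → ¬ P x) → ∀ xs →
  length (filter P? xs) ≡ 0
length-filter-none P? ¬P xs = cong length (filter-none P? (universal ¬P xs))

length-filter-map : ∀ {A B : Set} {P : Pred B 0ℓ} (P? : Decidable P) (f : A → B) xs →
  length (filter P? (map f xs)) ≡ length (filter (P? ∘ f) xs)
length-filter-map P? f []       = refl
length-filter-map P? f (x ∷ xs) with P? (f x)
... | yes _ = cong suc (length-filter-map P? f xs)
... | no _  = length-filter-map P? f xs

infix 4 _≟ˢ_
_≟ˢ_ : DecidableEquality (Subset n)
_≟ˢ_ = ≡-dec _≟ᵇ_

occurrences-in-allSubsets : ∀ n (t : Subset n) → length (filter (_≟ˢ t) (allSubsets n)) ≡ 1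
occurrences-in-allSubsets zero    []      = refl
occurrences-in-allSubsets (suc n) (b ∷ t) = begin
  length (filter (_≟ˢ b ∷ t) (map (false ∷_) subsets ++ map (true ∷_) subsets))
    ≡⟨ cong length (filter-++ (_≟ˢ b ∷ t) (map (false ∷_) subsets) (map (true ∷_) subsets)) ⟩
  length (filter (_≟ˢ b ∷ t) (map (false ∷_) subsets) ++ filter (_≟ˢ b ∷ t) (map (true ∷_) subsets))
    ≡⟨ length-++ (filter (_≟ˢ b ∷ t) (map (false ∷_) subsets)) ⟩
  length (filter (_≟ˢ b ∷ t) (map (false ∷_) subsets)) + length (filter (_≟ˢ b ∷ t) (map (true ∷_) subsets))
    ≡⟨ cong₂ _+_ (length-filter-map (_≟ˢ b ∷ t) (false ∷_) subsets)
                 (length-filter-map (_≟ˢ b ∷ t) (true ∷_) subsets) ⟩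
  length (filter (λ s → false ∷ s ≟ˢ b ∷ t) subsets) + length (filter (λ s → true ∷ s ≟ˢ b ∷ t) subsets)
    ≡⟨ by-head b ⟩
  1 ∎
  where
  open ≡-Reasoning
  subsets = allSubsets n

  same-head : ∀ x → length (filter (λ s → x ∷ s ≟ˢ x ∷ t) subsets) ≡ 1
  same-head x =
    trans (cong length (filter-≐ (λ s → x ∷ s ≟ˢ x ∷ t) (_≟ˢ t) (∷-injectiveʳ , cong (x ∷_)) subsets))
          (occurrences-in-allSubsets n t)

  other-head : ∀ {x y} → x ≢ y → length (filter (λ s → x ∷ s ≟ˢ y ∷ t) subsets) ≡ 0
  other-head x≢y = length-filter-none (λ s → _ ∷ s ≟ˢ _ ∷ t) (λ _ → x≢y ∘ ∷-injectiveˡ) subsets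

  by-head : ∀ b → length (filter (λ s → false ∷ s ≟ˢ b ∷ t) subsets)
                 + length (filter (λ s → true ∷ s ≟ˢ b ∷ t) subsets) ≡ 1
  by-head false = cong₂ _+_ (same-head false) (other-head λ ())
  by-head true  = cong₂ _+_ (other-head λ ()) (same-head true)

indicator : Bool → ℕ
indicator true  = 1
indicator false = 0

count₄ : Bool → Bool → Bool → Bool → ℕ
count₄ b₁ b₂ b₃ b₄ = indicator b₁ + (indicator b₂ + (indicator b₃ + indicator b₄))

neither : ¬ (false ≡ true ⊎ false ≡ true)
neither (inj₁ ())
neither (inj₂ ())

-- b₁ … b₄ are the edge indicators of abc, abd, acd, bcd; the six implications are the
-- third-edge rule for the six pairs of these triples.
count₄≢2,4 : ∀ b₁ b₂ b₃ b₄ →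
  (b₁ ≡ true → b₂ ≡ true → b₃ ≡ true ⊎ b₄ ≡ true) →
  (b₁ ≡ true → b₃ ≡ true → b₂ ≡ true ⊎ b₄ ≡ true) →
  (b₁ ≡ true → b₄ ≡ true → b₂ ≡ true ⊎ b₃ ≡ true) →
  (b₂ ≡ true → b₃ ≡ true → b₁ ≡ true ⊎ b₄ ≡ true) →
  (b₂ ≡ true → b₄ ≡ true → b₁ ≡ true ⊎ b₃ ≡ true) →
  (b₃ ≡ true → b₄ ≡ true → b₁ ≡ true ⊎ b₂ ≡ true) →
  ¬ (b₁ ≡ true × b₂ ≡ true × b₃ ≡ true × b₄ ≡ true) →
  ¬ count₄ b₁ b₂ b₃ b₄ ≡ 2 × ¬ count₄ b₁ b₂ b₃ b₄ ≡ 4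
count₄≢2,4 true  true  true  true  _   _   _   _   _   _   ¬all = ⊥-elim (¬all (refl , refl , refl , refl))
count₄≢2,4 true  true  false false r₁₂ _   _   _   _   _   _    = ⊥-elim (neither (r₁₂ refl refl))
count₄≢2,4 true  false true  false _   r₁₃ _   _   _   _   _    = ⊥-elim (neither (r₁₃ refl refl))
count₄≢2,4 true  false false true  _   _   r₁₄ _   _   _   _    = ⊥-elim (neither (r₁₄ refl refl))
count₄≢2,4 false true  true  false _   _   _   r₂₃ _   _   _    = ⊥-elim (neither (r₂₃ refl refl))
count₄≢2,4 false true  false true  _   _   _   _   r₂₄ _   _    = ⊥-elim (neither (r₂₄ refl refl))
count₄≢2,4 false false true  true  _   _   _   _   _   r₃₄ _    = ⊥-elim (neither (r₃₄ refl refl))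
count₄≢2,4 true  true  true  false _   _   _   _   _   _   _    = (λ ()) , (λ ())
count₄≢2,4 true  true  false true  _   _   _   _   _   _   _    = (λ ()) , (λ ())
count₄≢2,4 true  false true  true  _   _   _   _   _   _   _    = (λ ()) , (λ ())
count₄≢2,4 true  false false false _   _   _   _   _   _   _    = (λ ()) , (λ ())
count₄≢2,4 false true  true  true  _   _   _   _   _   _   _    = (λ ()) , (λ ())
count₄≢2,4 false true  false false _   _   _   _   _   _   _    = (λ ()) , (λ ())
count₄≢2,4 false false true  false _   _   _   _   _   _   _    = (λ ()) , (λ ())
count₄≢2,4 false false false true  _   _   _   _   _   _   _    = (λ ()) , (λ ())
count₄≢2,4 false false false false _   _   _   _   _   _   _    = (λ ()) , (λ ())

-- Edges, fans and the four-set rules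

module _ (H : ThreeGraph n) where

  E : Fin n → Fin n → Fin n → Set
  E a b c = IsEdge H (triple a b c)

  E? : ∀ a b c → Dec (E a b c)
  E? a b c = edge H (triple a b c) ≟ᵇ true

  E-swap : E a b c → E b a c
  E-swap {a = a} {b = b} {c = c} = subst (IsEdge H) (triple-swap a b c)

  E-flip : E a b c → E a c b
  E-flip {a = a} {b = b} {c = c} = subst (IsEdge H) (triple-flip a b c)

  E-rot : E a b c → E b c a
  E-rot = E-flip ∘ E-swap

  E-distinct : E a b c → Distinct a b c
  E-distinct = ∣triple∣≡3⇒distinct ∘ uniform H _

  Fan : Fin n → Fin n → Fin n → Fin n → Set
  Fan v x y z = E v x y × E v x z × E v y z

  fan-swap : Fan v x y z → Fan v y x z
  fan-swap (vxy , vxz , vyz) = E-flip vxy , vyz , vxz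

  FanThrough : Subset n → Set
  FanThrough e = Σ[ v ∈ Fin n ] Σ[ x ∈ Fin n ] Σ[ y ∈ Fin n ] Σ[ z ∈ Fin n ] Fan v x y z × e ≡ triple v x y

  record FourSetRules : Set where
    field
      third-edge : c ≢ d → E a b c → E a b d → E a c d ⊎ E b c d
      no-K₄      : E a b c → E a b d → E a c d → ¬ E b c d

  IsEdgeAt : Subset n → Pred (Subset n) 0ℓ
  IsEdgeAt t T = T ≡ t × IsEdge H T

  IsEdgeAt? : ∀ t → Decidable (IsEdgeAt t)
  IsEdgeAt? t T = (T ≟ˢ t) ×-dec (edge H T ≟ᵇ true)

  count-IsEdgeAt : ∀ t → length (filter (IsEdgeAt? t) (allSubsets n)) ≡ indicator (edge H t)
  count-IsEdgeAt t with edge H t in t-edge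
  ... | true  =
    trans (cong length (filter-≐ (IsEdgeAt? t) (_≟ˢ t) (proj₁ , λ { refl → refl , t-edge }) (allSubsets n)))
          (occurrences-in-allSubsets n t)
  ... | false =
    length-filter-none (IsEdgeAt? t) (λ { _ (refl , T-edge) → true≢false (trans (sym T-edge) t-edge) })
                       (allSubsets n)
    where
    true≢false : true ≢ false
    true≢false ()

  quad-edges≐four-triples : Distinct a b c → d ∉ triple a b c →
    (λ T → T ⊆ quad a b c d × IsEdge H T) ≐
    (λ T → IsEdgeAt (triple a b c) T ⊎ IsEdgeAt (triple a b d) T ⊎
           IsEdgeAt (triple a c d) T ⊎ IsEdgeAt (triple b c d) T)
  quad-edges≐four-triples abc d∉abc = in-quad⇒one-of , one-of⇒in-quad
    where
    in-quad⇒one-of : ∀ {T} → T ⊆ quad _ _ _ _ × IsEdge H T → _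
    in-quad⇒one-of {T} (T⊆abcd , T-edge) with 3-subset-of-quad abc d∉abc T (uniform H T T-edge) T⊆abcd
    ... | inj₁ T≡abc                 = inj₁ (T≡abc , T-edge)
    ... | inj₂ (inj₁ T≡abd)         = inj₂ (inj₁ (T≡abd , T-edge))
    ... | inj₂ (inj₂ (inj₁ T≡acd)) = inj₂ (inj₂ (inj₁ (T≡acd , T-edge)))
    ... | inj₂ (inj₂ (inj₂ T≡bcd)) = inj₂ (inj₂ (inj₂ (T≡bcd , T-edge)))

    one-of⇒in-quad : ∀ {T} → _ → T ⊆ quad _ _ _ _ × IsEdge H T
    one-of⇒in-quad (inj₁ (refl , T-edge))                 = ∈quad⁺ ∘ Sum.map₂ (Sum.map₂ inj₁) ∘ ∈triple⁻ , T-edge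
    one-of⇒in-quad (inj₂ (inj₁ (refl , T-edge)))         = ∈quad⁺ ∘ Sum.map₂ (Sum.map₂ inj₂) ∘ ∈triple⁻ , T-edge
    one-of⇒in-quad (inj₂ (inj₂ (inj₁ (refl , T-edge)))) = ∈quad⁺ ∘ Sum.map₂ inj₂ ∘ ∈triple⁻ , T-edge
    one-of⇒in-quad (inj₂ (inj₂ (inj₂ (refl , T-edge)))) = ∈quad⁺ ∘ inj₂ ∘ ∈triple⁻ , T-edge

  spanned-quad : Distinct a b c → d ∉ triple a b c →
    spannedEdges H (quad a b c d) ≡
      count₄ (edge H (triple a b c)) (edge H (triple a b d)) (edge H (triple a c d)) (edge H (triple b c d))
  spanned-quad {a = a} {b = b} {c = c} {d = d} abc d∉abc = begin
    spannedEdges H (quad a b c d)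
      ≡⟨ cong length (filter-≐ _ (abc? ∪? abd? ∪? acd? ∪? bcd?)
                               (quad-edges≐four-triples abc d∉abc) (allSubsets n)) ⟩
    # (abc? ∪? abd? ∪? acd? ∪? bcd?)
      ≡⟨ length-filter-∪ abc? _ (λ { (refl , _) → d∉abc ∘ d∈ }) (allSubsets n) ⟩
    # abc? + # (abd? ∪? acd? ∪? bcd?)
      ≡⟨ cong (# abc? +_) (length-filter-∪ abd? _ (λ { (refl , _) → c∉abd ∘ c∈ }) (allSubsets n)) ⟩
    # abc? + (# abd? + # (acd? ∪? bcd?))
      ≡⟨ cong (λ k → # abc? + (# abd? + k))
              (length-filter-∪ acd? _ (λ { (refl , _) → b∉acd ∘ b∈ }) (allSubsets n)) ⟩
    # abc? + (# abd? + (# acd? + # bcd?))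
      ≡⟨ cong₂ _+_ (count-IsEdgeAt _)
           (cong₂ _+_ (count-IsEdgeAt _) (cong₂ _+_ (count-IsEdgeAt _) (count-IsEdgeAt _))) ⟩
    count₄ (edge H (triple a b c)) (edge H (triple a b d)) (edge H (triple a c d)) (edge H (triple b c d)) ∎
    where
    open ≡-Reasoning
    abc? = IsEdgeAt? (triple a b c)
    abd? = IsEdgeAt? (triple a b d)
    acd? = IsEdgeAt? (triple a c d)
    bcd? = IsEdgeAt? (triple b c d)

    # : ∀ {P} → Decidable P → ℕ
    # P? = length (filter P? (allSubsets n))

    a≢d = proj₁ (∉triple⁻ d∉abc)
    b≢d = proj₁ (proj₂ (∉triple⁻ d∉abc))
    c≢d = proj₂ (proj₂ (∉triple⁻ d∉abc))
    c∉abd = ∉triple (≢-sym (distinct₁₃ abc)) (≢-sym (distinct₂₃ abc)) c≢d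
    b∉acd = ∉triple (≢-sym (distinct₁₂ abc)) (distinct₂₃ abc) b≢d

    d∈ : ∀ {T} → IsEdgeAt (triple a b d) T ⊎ IsEdgeAt (triple a c d) T ⊎ IsEdgeAt (triple b c d) T → d ∈ T
    d∈ (inj₁ (refl , _))         = ∈triple⁺ (inj₂ (inj₂ refl))
    d∈ (inj₂ (inj₁ (refl , _))) = ∈triple⁺ (inj₂ (inj₂ refl))
    d∈ (inj₂ (inj₂ (refl , _))) = ∈triple⁺ (inj₂ (inj₂ refl))

    c∈ : ∀ {T} → IsEdgeAt (triple a c d) T ⊎ IsEdgeAt (triple b c d) T → c ∈ T
    c∈ (inj₁ (refl , _)) = ∈triple⁺ (inj₂ (inj₁ refl))
    c∈ (inj₂ (refl , _)) = ∈triple⁺ (inj₂ (inj₁ refl))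

    b∈ : ∀ {T} → IsEdgeAt (triple b c d) T → b ∈ T
    b∈ (refl , _) = ∈triple⁺ (inj₁ refl)

  free⇒rules : Free-4,2-4,4 H → FourSetRules
  free⇒rules free = record { third-edge = third-edge ; no-K₄ = no-K₄ }
    where
    spans-not : Distinct a b c → d ∉ triple a b c → ∀ {k} →
      count₄ (edge H (triple a b c)) (edge H (triple a b d)) (edge H (triple a c d)) (edge H (triple b c d)) ≡ k →
      ¬ k ≡ 2 × ¬ k ≡ 4
    spans-not {a = a} {b = b} {c = c} {d = d} abc d∉abc count≡k =
      let ¬2 , ¬4 = free (quad a b c d) (∣quad∣≡4 abc d∉abc)
          spanned≡k = trans (spanned-quad abc d∉abc) count≡k
      in (¬2 ∘ trans spanned≡k) , (¬4 ∘ trans spanned≡k)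

    third-edge : c ≢ d → E a b c → E a b d → E a c d ⊎ E b c d
    third-edge {c = c} {d = d} {a = a} {b = b} c≢d abc abd with E? a c d | E? b c d
    ... | yes acd | _       = inj₁ acd
    ... | no _    | yes bcd = inj₂ bcd
    ... | no ¬acd | no ¬bcd = ⊥-elim (proj₁ (spans-not (E-distinct abc) d∉abc count≡2) refl)
      where
      d∉abc = ∉triple (≢-sym (distinct₁₃ (E-distinct abd))) (≢-sym (distinct₂₃ (E-distinct abd))) (≢-sym c≢d)
      count≡2 : count₄ (edge H (triple a b c)) (edge H (triple a b d)) (edge H (triple a c d)) (edge H (triple b c d)) ≡ 2
      count≡2 rewrite abc | abd | ¬-not ¬acd | ¬-not ¬bcd = refl

    no-K₄ : E a b c → E a b d → E a c d → ¬ E b c d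
    no-K₄ {a = a} {b = b} {c = c} {d = d} abc abd acd bcd =
      proj₂ (spans-not (E-distinct abc) d∉abc count≡4) refl
      where
      d∉abc = ∉triple (≢-sym (distinct₁₃ (E-distinct abd))) (≢-sym (distinct₂₃ (E-distinct abd)))
                      (≢-sym (distinct₂₃ (E-distinct acd)))
      count≡4 : count₄ (edge H (triple a b c)) (edge H (triple a b d)) (edge H (triple a c d)) (edge H (triple b c d)) ≡ 4
      count≡4 rewrite abc | abd | acd | bcd = refl

  rules⇒free : FourSetRules → Free-4,2-4,4 H
  rules⇒free rules S ∣S∣≡4 with quad-view S ∣S∣≡4
  ... | a , b , c , d , abc@(a≢b , a≢c , b≢c) , d∉abc , refl rewrite spanned-quad abc d∉abc =
    count₄≢2,4 (edge H (triple a b c)) (edge H (triple a b d)) (edge H (triple a c d)) (edge H (triple b c d))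
      (third-edge c≢d)
      (λ abc acd → Sum.map₂ E-swap (third-edge b≢d (E-flip abc) acd))
      (λ abc bcd → Sum.map E-swap E-swap (third-edge a≢d (E-rot abc) bcd))
      (λ abd acd → Sum.map₂ E-rot (third-edge b≢c (E-flip abd) (E-flip acd)))
      (λ abd bcd → Sum.map E-swap E-rot (third-edge a≢c (E-rot abd) (E-flip bcd)))
      (λ acd bcd → Sum.map E-rot E-rot (third-edge a≢b (E-rot acd) (E-rot bcd)))
      (λ (abc , abd , acd , bcd) → no-K₄ abc abd acd bcd)
    where
    open FourSetRules rules
    a≢d = proj₁ (∉triple⁻ d∉abc)
    b≢d = proj₁ (proj₂ (∉triple⁻ d∉abc))
    c≢d = proj₂ (proj₂ (∉triple⁻ d∉abc))

  -- Tight components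

  shared-pair-step : E a b c → E a b d → c ≢ d → TightStep H (triple a b c) (triple a b d)
  shared-pair-step abc abd c≢d =
    let a≢b , a≢c , b≢c = E-distinct abc
    in abc , abd , ∣triple∩triple∣≡2 a≢b (∉triple (≢-sym a≢c) (≢-sym b≢c) c≢d)

  TightStep? : ∀ e → Decidable (TightStep H e)
  TightStep? e g = (edge H e ≟ᵇ true) ×-dec ((edge H g ≟ᵇ true) ×-dec (∣ e ∩ g ∣ ℕ.≟ 2))

  TightStep-sym : TightStep H e f → TightStep H f e
  TightStep-sym {e = e} {f = f} (e-edge , f-edge , ∣e∩f∣≡2) =
    f-edge , e-edge , trans (cong ∣_∣ (∩-comm f e)) ∣e∩f∣≡2

  TightWalk-edge : IsEdge H e → TightWalk H e f → IsEdge H f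
  TightWalk-edge e-edge ε                       = e-edge
  TightWalk-edge _      ((_ , f-edge , _) ◅ walk) = TightWalk-edge f-edge walk

  reach-tightlyConnected : IsEdge H e → TightlyConnectedSet H (TightWalk H e)
  reach-tightlyConnected e-edge =
    (λ _ walk → TightWalk-edge e-edge walk) ,
    (λ _ _ e⇝f e⇝g _ → reverse TightStep-sym e⇝f ◅◅ e⇝g)

  reach-isTightComponent : IsEdge H e → IsTightComponent H (TightWalk H e)
  reach-isTightComponent {e = e} e-edge = reach-tightlyConnected e-edge , (e , ε) , maximal
    where
    maximal : ∀ D → TightlyConnectedSet H D → (∀ f → TightWalk H e f → D f) → ∀ f → D f → TightWalk H e f
    maximal D (_ , D-connected) reach⊆D f f∈D with f ≟ˢ e
    ... | yes refl = ε
    ... | no f≢e   = D-connected e f (reach⊆D e ε) f∈D (f≢e ∘ sym)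

  tightComponent≐reach : IsTightComponent H C → C e → C ≐ TightWalk H e
  tightComponent≐reach {C = C} {e = e} ((C-edges , C-connected) , _ , maximal) e∈C =
    C⊆reach , maximal (TightWalk H e) (reach-tightlyConnected (C-edges e e∈C)) (λ _ → C⊆reach) _
    where
    C⊆reach : ∀ {f} → C f → TightWalk H e f
    C⊆reach {f} f∈C with f ≟ˢ e
    ... | yes refl = ε
    ... | no f≢e   = C-connected e f e∈C f∈C (f≢e ∘ sym)

  stars⇒rules : (∀ C → IsTightComponent H C → IsStar C) → FourSetRules
  stars⇒rules stars = record { third-edge = third-edge ; no-K₄ = no-K₄ }
    where
    third-edge : c ≢ d → E a b c → E a b d → E a c d ⊎ E b c d
    third-edge {c = c} {d = d} {a = a} {b = b} c≢d abc abd with stars _ (reach-isTightComponent abc)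
    ... | v , S , _ , in-star , from-star =
      by-center (∈triple⁻ (center∈ abc-star)) (∈triple⁻ (center∈ abd-star))
      where
      abc-star = in-star _ ε
      abd-star = in-star _ (shared-pair-step abc abd c≢d ◅ ε)

      far-edge : v ≢ c → v ≢ d → E v c d
      far-edge v≢c v≢d = TightWalk-edge abc (from-star _
        (c , d , leaf∈ abc-star (∈triple⁺ (inj₂ (inj₂ refl))) (≢-sym v≢c) ,
                 leaf∈ abd-star (∈triple⁺ (inj₂ (inj₂ refl))) (≢-sym v≢d) , c≢d , refl))

      by-center : v ≡ a ⊎ v ≡ b ⊎ v ≡ c → v ≡ a ⊎ v ≡ b ⊎ v ≡ d → E a c d ⊎ E b c d
      by-center (inj₁ refl)         _ = inj₁ (far-edge (distinct₁₃ (E-distinct abc)) (distinct₁₃ (E-distinct abd)))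
      by-center (inj₂ (inj₁ refl)) _ = inj₂ (far-edge (distinct₂₃ (E-distinct abc)) (distinct₂₃ (E-distinct abd)))
      by-center (inj₂ (inj₂ refl)) (inj₁ refl)         = ⊥-elim (distinct₁₃ (E-distinct abc) refl)
      by-center (inj₂ (inj₂ refl)) (inj₂ (inj₁ refl)) = ⊥-elim (distinct₂₃ (E-distinct abc) refl)
      by-center (inj₂ (inj₂ refl)) (inj₂ (inj₂ refl)) = ⊥-elim (c≢d refl)

    no-K₄ : E a b c → E a b d → E a c d → ¬ E b c d
    no-K₄ {a = a} {b = b} {c = c} {d = d} abc abd acd bcd with stars _ (reach-isTightComponent abc)
    ... | v , S , _ , in-star , _ = by-center (∈triple⁻ (center-of ε))
      where
      center-of : TightWalk H (triple a b c) e → v ∈ e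
      center-of walk = center∈ (in-star _ walk)

      a≢b = distinct₁₂ (E-distinct abc)
      a≢c = distinct₁₃ (E-distinct abc)
      b≢c = distinct₂₃ (E-distinct abc)
      a≢d = distinct₁₃ (E-distinct abd)
      b≢d = distinct₂₃ (E-distinct abd)
      c≢d = distinct₂₃ (E-distinct acd)

      to-acd : TightStep H (triple a b c) (triple a c d)
      to-acd = subst (λ t → TightStep H t (triple a c d)) (sym (triple-flip a b c))
                     (shared-pair-step (E-flip abc) acd b≢d)

      to-bcd : TightStep H (triple a b c) (triple b c d)
      to-bcd = subst (λ t → TightStep H t (triple b c d)) (sym (triple-rot a b c))
                     (shared-pair-step (E-rot abc) bcd a≢d)

      by-center : ¬ (v ≡ a ⊎ v ≡ b ⊎ v ≡ c)
      by-center (inj₁ refl)         = ∉triple a≢b a≢c a≢d (center-of (to-bcd ◅ ε))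
      by-center (inj₂ (inj₁ refl)) = ∉triple (≢-sym a≢b) b≢c b≢d (center-of (to-acd ◅ ε))
      by-center (inj₂ (inj₂ refl)) =
        ∉triple (≢-sym a≢c) (≢-sym b≢c) c≢d (center-of (shared-pair-step abc abd c≢d ◅ ε))

  CompleteStar : Fin n → Subset n → Set
  CompleteStar v S = ∀ {a b} → a ∈ S → b ∈ S → a ≢ b → E v a b

  star-pivot : CompleteStar v S →
    a ∈ S → b ∈ S → c ∈ S → a ≢ b → a ≢ c → TightWalk H (triple v a b) (triple v a c)
  star-pivot {b = b} {c = c} clique a∈S b∈S c∈S a≢b a≢c with b ≟ c
  ... | yes refl = ε
  ... | no b≢c   = shared-pair-step (clique a∈S b∈S a≢b) (clique a∈S c∈S a≢c) b≢c ◅ ε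

  complete-star-connected : CompleteStar v S →
    StarTriple v S e → StarTriple v S f → TightWalk H e f
  complete-star-connected {v = v} clique (a , b , a∈S , b∈S , a≢b , refl) (c , d , c∈S , d∈S , c≢d , refl)
    with a ≟ c
  ... | yes refl = star-pivot clique a∈S b∈S d∈S a≢b c≢d
  ... | no a≢c   = star-pivot clique a∈S b∈S c∈S a≢b a≢c ◅◅
                   subst (λ t → TightWalk H t (triple v c d)) (triple-flip v c a)
                         (star-pivot clique c∈S a∈S d∈S (a≢c ∘ sym) c≢d)

  component-is-star : IsTightComponent H C → C e → StarTriple v S e → v ∉ S →
    CompleteStar v S →
    (∀ {f g} → StarTriple v S f → TightStep H f g → StarTriple v S g) → IsStar C
  component-is-star {v = v} {S = S} C-component e∈C e-star v∉S clique closed =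
    v , S , v∉S ,
    (λ _ f∈C → walk-closed e-star (proj₁ C≐reach f∈C)) ,
    (λ _ f-star → proj₂ C≐reach (complete-star-connected clique e-star f-star))
    where
    C≐reach = tightComponent≐reach C-component e∈C
    walk-closed : StarTriple v S f → TightWalk H f g → StarTriple v S g
    walk-closed f-star ε             = f-star
    walk-closed f-star (step ◅ walk) = walk-closed (closed f-star step) walk

  isolated-edge-star : IsTightComponent H C → C (triple a b c) →
    (∀ g → ¬ TightStep H (triple a b c) g) → IsStar C
  isolated-edge-star {C = C} {a = a} {b = b} {c = c} C-component abc∈C isolated =
    component-is-star C-component abc∈C (b , c , b∈bc , c∈bc , b≢c , refl) a∉bc clique closed
    where
    abc = proj₁ (proj₁ C-component) _ abc∈C
    a≢b = distinct₁₂ (E-distinct abc)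
    a≢c = distinct₁₃ (E-distinct abc)
    b≢c = distinct₂₃ (E-distinct abc)
    b∈bc = ∈pair⁺ (inj₁ refl)
    c∈bc = ∈pair⁺ (inj₂ refl)
    a∉bc : a ∉ ⁅ b ⁆ ∪ ⁅ c ⁆
    a∉bc = Sum.[ a≢b , a≢c ] ∘ ∈pair⁻

    only-abc : StarTriple a (⁅ b ⁆ ∪ ⁅ c ⁆) f → f ≡ triple a b c
    only-abc (x , y , x∈ , y∈ , x≢y , refl) with ∈pair⁻ x∈ | ∈pair⁻ y∈
    ... | inj₁ refl | inj₁ refl = ⊥-elim (x≢y refl)
    ... | inj₁ refl | inj₂ refl = refl
    ... | inj₂ refl | inj₁ refl = triple-flip a c b
    ... | inj₂ refl | inj₂ refl = ⊥-elim (x≢y refl)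

    clique : CompleteStar a (⁅ b ⁆ ∪ ⁅ c ⁆)
    clique x∈ y∈ x≢y = subst (IsEdge H) (sym (only-abc (_ , _ , x∈ , y∈ , x≢y , refl))) abc

    closed : StarTriple a (⁅ b ⁆ ∪ ⁅ c ⁆) f → TightStep H f g → StarTriple a (⁅ b ⁆ ∪ ⁅ c ⁆) g
    closed f-star step = ⊥-elim (isolated _ (subst (λ t → TightStep H t _) (only-abc f-star) step))

  -- Stars around fans

  module _ (rules : FourSetRules) where

    open FourSetRules rules

    -- Without vyw, the third-edge rule on the 4-sets through w forces both vzw and xzw,
    -- and then {v, x, z, w} spans a K₄.
    fan-extend : Fan v x y z → y ≢ w → E v x w → E v y w
    fan-extend {v = v} {x = x} {y = y} {z = z} {w = w} (vxy , vxz , vyz) y≢w vxw with w ≟ z | E? v y w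
    ... | yes refl | _       = vyz
    ... | no _     | yes vyw = vyw
    ... | no w≢z   | no ¬vyw = ⊥-elim (no-K₄ vxz vxw (proj₁ vzw×xzw) (proj₂ vzw×xzw))
      where
      v≢w = distinct₁₃ (E-distinct vxw)
      x≢z = distinct₂₃ (E-distinct vxz)
      y≢z = distinct₂₃ (E-distinct vyz)

      xyw : E x y w
      xyw = Sum.[ ⊥-elim ∘ ¬vyw , id ] (third-edge y≢w vxy vxw)

      ¬xyz : ¬ E x y z
      ¬xyz = no-K₄ vxy vxz vyz

      xzw-from : E v z w → E x z w
      xzw-from vzw =
        let zyw = Sum.[ ⊥-elim ∘ ¬vyw , id ] (third-edge y≢w (E-flip vyz) vzw)
        in E-rot (Sum.[ ⊥-elim ∘ ¬xyz ∘ E-swap , id ] (third-edge x≢z (E-rot xyw) (E-rot zyw)))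

      vzw-from : E x z w → E v z w
      vzw-from xzw =
        let wyz = Sum.[ ⊥-elim ∘ ¬xyz , id ] (third-edge y≢z (E-flip xyw) (E-flip xzw))
        in E-swap (Sum.[ ⊥-elim ∘ ¬vyw ∘ E-swap , id ] (third-edge v≢w (E-rot vyz) (E-rot wyz)))

      vzw×xzw : E v z w × E x z w
      vzw×xzw with third-edge (w≢z ∘ sym) vxz vxw
      ... | inj₁ vzw = vzw , xzw-from vzw
      ... | inj₂ xzw = vzw-from xzw , xzw

    spoke-fan : Fan v x y z → E v x u → Σ[ t ∈ Fin n ] Fan v x u t
    spoke-fan {y = y} {u = u} fan@(vxy , _ , _) vxu with y ≟ u
    ... | yes refl = _ , fan
    ... | no y≢u   = _ , vxu , vxy , E-flip (fan-extend fan y≢u vxu)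

    shared-pair-fan : c ≢ d → E a b c → E a b d → e ≡ triple a b c → FanThrough e
    shared-pair-fan c≢d abc abd e≡abc with third-edge c≢d abc abd
    ... | inj₁ acd = _ , _ , _ , _ , (abc , abd , acd) , e≡abc
    ... | inj₂ bcd = _ , _ , _ , _ , (E-swap abc , E-swap abd , bcd) , trans e≡abc (triple-swap _ _ _)

    step-fan : TightStep H e g → FanThrough e
    step-fan {e = e} {g = g} (e-edge , g-edge , ∣e∩g∣≡2) with triple-view e (uniform H e e-edge)
    ... | a , b , c , refl with step-shape g (uniform H g g-edge) ∣e∩g∣≡2 (E-distinct e-edge)
    ... | w , w∉abc , inj₁ refl =
      shared-pair-fan (proj₂ (proj₂ (∉triple⁻ w∉abc))) e-edge g-edge refl
    ... | w , w∉abc , inj₂ (inj₁ refl) =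
      shared-pair-fan (proj₁ (proj₂ (∉triple⁻ w∉abc))) (E-flip e-edge) g-edge (triple-flip a b c)
    ... | w , w∉abc , inj₂ (inj₂ refl) =
      shared-pair-fan (proj₁ (∉triple⁻ w∉abc)) (E-rot e-edge) g-edge (triple-rot a b c)

    module FanStar {v x y z : Fin n} (fan : Fan v x y z) where

      leaves : Subset n
      leaves = ⁅ x ⁆ ∪ tabulate (λ u → edge H (triple v x u))

      ∈leaves⁻ : u ∈ leaves → u ≡ x ⊎ E v x u
      ∈leaves⁻ u∈ = Sum.map (x∈⁅y⁆⇒x≡y x) ∈tabulate⁻ (x∈p∪q⁻ ⁅ x ⁆ _ u∈)

      ∈leaves⁺ : u ≡ x ⊎ E v x u → u ∈ leaves
      ∈leaves⁺ = x∈p∪q⁺ ∘ Sum.map (λ { refl → x∈⁅x⁆ x }) ∈tabulate⁺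

      v∉leaves : v ∉ leaves
      v∉leaves v∈ with ∈leaves⁻ v∈
      ... | inj₁ v≡x = distinct₁₂ (E-distinct (proj₁ fan)) v≡x
      ... | inj₂ vxv = distinct₁₃ (E-distinct vxv) refl

      leaves-clique : CompleteStar v leaves
      leaves-clique a∈ b∈ a≢b with ∈leaves⁻ a∈ | ∈leaves⁻ b∈
      ... | inj₁ refl | inj₁ refl = ⊥-elim (a≢b refl)
      ... | inj₁ refl | inj₂ vxb  = vxb
      ... | inj₂ vxa  | inj₁ refl = E-flip vxa
      ... | inj₂ vxa  | inj₂ vxb  = fan-extend (proj₂ (spoke-fan fan vxa)) a≢b vxb

      leaves-closed : a ∈ leaves → E v a w → w ∈ leaves
      leaves-closed {w = w} a∈ vaw with ∈leaves⁻ a∈ | w ≟ x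
      ... | inj₁ refl | _        = ∈leaves⁺ (inj₂ vaw)
      ... | inj₂ _    | yes w≡x = ∈leaves⁺ (inj₁ w≡x)
      ... | inj₂ vxa  | no w≢x  =
        ∈leaves⁺ (inj₂ (fan-extend (fan-swap (proj₂ (spoke-fan fan vxa))) (w≢x ∘ sym) vaw))

      star-step-closed : StarTriple v leaves f → TightStep H f g → StarTriple v leaves g
      star-step-closed (a , b , a∈ , b∈ , a≢b , refl) (vab , g-edge , ∣∩∣≡2)
        with step-shape _ (uniform H _ g-edge) ∣∩∣≡2 (E-distinct vab)
      ... | w , _ , inj₁ refl =
        a , w , a∈ , leaves-closed a∈ g-edge , distinct₂₃ (E-distinct g-edge) , refl
      ... | w , _ , inj₂ (inj₁ refl) =
        b , w , b∈ , leaves-closed b∈ g-edge , distinct₂₃ (E-distinct g-edge) , refl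
      ... | w , w∉vab , inj₂ (inj₂ refl) =
        ⊥-elim (no-K₄ vab (leaves-clique a∈ w∈ a≢w) (leaves-clique b∈ w∈ b≢w) g-edge)
        where
        a≢w = distinct₁₃ (E-distinct g-edge)
        b≢w = distinct₂₃ (E-distinct g-edge)
        w∈ : w ∈ leaves
        w∈ = Sum.[ leaves-closed a∈ ∘ E-swap , leaves-closed b∈ ∘ E-swap ]′
               (third-edge (proj₁ (∉triple⁻ w∉vab)) (E-rot vab) g-edge)

      is-star : IsTightComponent H C → C (triple v x y) → IsStar C
      is-star C-component vxy∈C =
        component-is-star C-component vxy∈C
          (x , y , ∈leaves⁺ (inj₁ refl) , ∈leaves⁺ (inj₂ (proj₁ fan)) , x≢y , refl)
          v∉leaves leaves-clique star-step-closed
        where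
        x≢y = distinct₂₃ (E-distinct (proj₁ fan))

    rules⇒stars : ∀ C → IsTightComponent H C → IsStar C
    rules⇒stars C C-component@((C-edges , _) , (e , e∈C) , _) with triple-view e (uniform H e (C-edges e e∈C))
    ... | a , b , c , refl with anySubset? (TightStep? (triple a b c))
    ...   | no isolated    = isolated-edge-star C-component e∈C (λ g step → isolated (g , step))
    ...   | yes (_ , step) with step-fan step
    ...     | _ , _ , _ , _ , fan , abc≡vxy = FanStar.is-star fan C-component (subst C abc≡vxy e∈C)

theorem4p1 : ∀ {n : ℕ} (H : ThreeGraph n) →
    (Free-4,2-4,4 H → ∀ (C : Subset n → Set) → IsTightComponent H C → IsStar C) ×
    ((∀ (C : Subset n → Set) → IsTightComponent H C → IsStar C) → Free-4,2-4,4 H)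
theorem4p1 H = rules⇒stars H ∘ free⇒rules H , rules⇒free H ∘ stars⇒rules H
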